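{- Let $I_{2^k}$ denote the $2^k\times2^k$ binary identity matrix. For every $k\ge1$, $$\mathtt{phlin}(I_{2^k})=\mathtt{phlin}(I_{2^{k-1}})\,0^{4^{k-1}}\,\mathtt{phlin}(I_{2^{k-1}})\,0^{4^{k-1}}.$$
   Context: For a matrix $\mathcal{M}$ of size $2^i\times2^i$ with $i\ge1$, its quadrants are $UL(\mathcal{M})=\mathcal{M}[1..2^{i-1}][1..2^{i-1}]$, $UR(\mathcal{M})=\mathcal{M}[1..2^{i-1}][2^{i-1}+1..2^i]$, $LL(\mathcal{M})=\mathcal{M}[2^{i-1}+1..2^i][1..2^{i-1}]$, $LR(\mathcal{M})=\mathcal{M}[2^{i-1}+1..2^i][2^{i-1}+1..2^i]$. The scans $\mathtt{ls},\mathtt{rs},\mathtt{us},\mathtt{ds}$ map $2^i\times2^i$ matrices to 1D strings: all equal the single symbol if the matrix is $1\times1$; otherwise (with $\cdot$ string concatenation) $\mathtt{rs}(\mathcal{M})=\mathtt{ds}(UL)\cdot\mathtt{rs}(UR)\cdot\mathtt{rs}(LR)\cdot\mathtt{us}(LL)$, $\mathtt{ds}(\mathcal{M})=\mathtt{rs}(UL)\cdot\mathtt{ds}(LL)\cdot\mathtt{ds}(LR)\cdot\mathtt{ls}(UR)$, $\mathtt{us}(\mathcal{M})=\mathtt{ls}(LR)\cdot\mathtt{us}(UR)\cdot\mathtt{us}(UL)\cdot\mathtt{rs}(LL)$, $\mathtt{ls}(\mathcal{M})=\mathtt{us}(LR)\cdot\mathtt{ls}(LL)\cdot\mathtt{ls}(UL)\cdot\mathtt{ds}(UR)$,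 where quadrants are those of $\mathcal{M}$. The Peano-Hilbert linearization is $\mathtt{phlin}(\mathcal{M})=\mathtt{rs}(\mathcal{M})$ if $i$ is odd and $\mathtt{phlin}(\mathcal{M})=\mathtt{ds}(\mathcal{M})$ if $i$ is even. -}

module Defs where

open import Data.Nat using (ℕ; zero; suc; _^_; _+_)
open import Data.Fin using (Fin; zero; suc; _↑ˡ_; _↑ʳ_; _≟_)
open import Data.List using (List; [_]; _++_; replicate)
open import Data.Bool using (Bool; true; false; if_then_else_)
open import Relation.Nullary using (does)

isEven : ℕ → Bool
isEven zero = true
isEven (suc zero) = false
isEven (suc (suc n)) = isEven n

-- A 2^i × 2^i matrix over A, indexed by (row, column), 0-based.
Mat : Set → ℕ → Set
Mat A i = Fin (2 ^ i) → Fin (2 ^ i) → A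

-- 2 ^ suc i reduces definitionally to 2 ^ i + (2 ^ i + 0).
-- Embeddings of the first and second halves of Fin (2 ^ suc i).
lo : ∀ i → Fin (2 ^ i) → Fin (2 ^ suc i)
lo i x = x ↑ˡ (2 ^ i + 0)

hi : ∀ i → Fin (2 ^ i) → Fin (2 ^ suc i)
hi i x = 2 ^ i ↑ʳ (x ↑ˡ 0)

module _ {A : Set} where
  UL UR LL LR : ∀ i → Mat A (suc i) → Mat A i
  UL i M r c = M (lo i r) (lo i c)
  UR i M r c = M (lo i r) (hi i c)
  LL i M r c = M (hi i r) (lo i c)
  LR i M r c = M (hi i r) (hi i c)

  rs ds us ls : ∀ i → Mat A i → List A
  rs zero M = [ M zero zero ]
  rs (suc i) M = ds i (UL i M) ++ rs i (UR i M) ++ rs i (LR i M) ++ us i (LL i M)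
  ds zero M = [ M zero zero ]
  ds (suc i) M = rs i (UL i M) ++ ds i (LL i M) ++ ds i (LR i M) ++ ls i (UR i M)
  us zero M = [ M zero zero ]
  us (suc i) M = ls i (LR i M) ++ us i (UR i M) ++ us i (UL i M) ++ rs i (LL i M)
  ls zero M = [ M zero zero ]
  ls (suc i) M = us i (LR i M) ++ ls i (LL i M) ++ ls i (UL i M) ++ ds i (UR i M)

  phlin : ∀ i → Mat A i → List A
  phlin i M = if isEven i then ds i M else rs i M

I : ∀ k → Mat ℕ k
I k r c = if does (r ≟ c) then 1 else 0

{-# OPTIONS --safe #-}
-- The identity matrix is symmetric, and transposition exchanges the scans rs
-- and ds, so phlin (I k) = ds (I k) whatever the parity of k. Unfolding ds once,
-- the diagonal quadrants of I (suc k) are I k and the off-diagonal ones are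
-- zero, and every scan of a constant 2^k × 2^k matrix is a constant list of
-- length 4^k.
module Submission where

open import Defs
open import Data.Nat using (zero; suc; _^_; _+_; _*_)
open import Data.Nat.Properties using (*-identityˡ)
open import Data.Fin using (Fin; _≟_; splitAt)
open import Data.Fin.Properties using (↑ˡ-injective; ↑ʳ-injective; splitAt-↑ˡ; splitAt-↑ʳ)
open import Data.List using (List; _∷_; _++_; replicate)
open import Data.Bool using (true; false; if_then_else_)
open import Function.Bundles using (mk⇔)
open import Function.Definitions using (Injective)
open import Relation.Nullary.Decidable using (does-⇔; dec-false)
open import Relation.Binary.PropositionalEquality
  using (_≡_; _≢_; refl; sym; trans; cong; module ≡-Reasoning)

infix 4 _≗₂_

_≗₂_ : {X Y B : Set} → (X → Y → B) → (X → Y → B) → Set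
M ≗₂ N = ∀ r c → M r c ≡ N r c

transpose : {X B : Set} → (X → X → B) → X → X → B
transpose M r c = M c r

module _ {A : Set} where

  cong₄-++ : {a a′ b b′ c c′ d d′ : List A} →
             a ≡ a′ → b ≡ b′ → c ≡ c′ → d ≡ d′ →
             a ++ b ++ c ++ d ≡ a′ ++ b′ ++ c′ ++ d′
  cong₄-++ refl refl refl refl = refl

  replicate-+ : ∀ m n (x : A) → replicate (m + n) x ≡ replicate m x ++ replicate n x
  replicate-+ zero    n x = refl
  replicate-+ (suc m) n x = cong (x ∷_) (replicate-+ m n x)

  replicate-4* : ∀ n (x : A) →
                 replicate (4 * n) x ≡ replicate n x ++ replicate n x ++ replicate n x ++ replicate n x
  replicate-4* n x = begin
    replicate (4 * n) x                                        ≡⟨ replicate-+ n (3 * n) x ⟩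
    xs ++ replicate (3 * n) x                                  ≡⟨ cong (xs ++_) (replicate-+ n (2 * n) x) ⟩
    xs ++ xs ++ replicate (2 * n) x                            ≡⟨ cong (λ ys → xs ++ xs ++ ys) (replicate-+ n (1 * n) x) ⟩
    xs ++ xs ++ xs ++ replicate (1 * n) x                      ≡⟨ cong (λ m → xs ++ xs ++ xs ++ replicate m x) (*-identityˡ n) ⟩
    xs ++ xs ++ xs ++ xs                                       ∎
    where
    open ≡-Reasoning
    xs : List A
    xs = replicate n x

  rs-cong : ∀ i {M N : Mat A i} → M ≗₂ N → rs i M ≡ rs i N
  ds-cong : ∀ i {M N : Mat A i} → M ≗₂ N → ds i M ≡ ds i N
  us-cong : ∀ i {M N : Mat A i} → M ≗₂ N → us i M ≡ us i N
  ls-cong : ∀ i {M N : Mat A i} → M ≗₂ N → ls i M ≡ ls i N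
  rs-cong zero    M≗N = cong (_∷ _) (M≗N _ _)
  rs-cong (suc i) M≗N = cong₄-++ (ds-cong i λ _ _ → M≗N _ _) (rs-cong i λ _ _ → M≗N _ _)
                                 (rs-cong i λ _ _ → M≗N _ _) (us-cong i λ _ _ → M≗N _ _)
  ds-cong zero    M≗N = cong (_∷ _) (M≗N _ _)
  ds-cong (suc i) M≗N = cong₄-++ (rs-cong i λ _ _ → M≗N _ _) (ds-cong i λ _ _ → M≗N _ _)
                                 (ds-cong i λ _ _ → M≗N _ _) (ls-cong i λ _ _ → M≗N _ _)
  us-cong zero    M≗N = cong (_∷ _) (M≗N _ _)
  us-cong (suc i) M≗N = cong₄-++ (ls-cong i λ _ _ → M≗N _ _) (us-cong i λ _ _ → M≗N _ _)
                                 (us-cong i λ _ _ → M≗N _ _) (rs-cong i λ _ _ → M≗N _ _)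
  ls-cong zero    M≗N = cong (_∷ _) (M≗N _ _)
  ls-cong (suc i) M≗N = cong₄-++ (us-cong i λ _ _ → M≗N _ _) (ls-cong i λ _ _ → M≗N _ _)
                                 (ls-cong i λ _ _ → M≗N _ _) (ds-cong i λ _ _ → M≗N _ _)

  rs≡ds-transpose : ∀ i (M : Mat A i) → rs i M ≡ ds i (transpose M)
  ds≡rs-transpose : ∀ i (M : Mat A i) → ds i M ≡ rs i (transpose M)
  us≡ls-transpose : ∀ i (M : Mat A i) → us i M ≡ ls i (transpose M)
  ls≡us-transpose : ∀ i (M : Mat A i) → ls i M ≡ us i (transpose M)
  rs≡ds-transpose zero    M = refl
  rs≡ds-transpose (suc i) M = cong₄-++ (ds≡rs-transpose i _) (rs≡ds-transpose i _)
                                       (rs≡ds-transpose i _) (us≡ls-transpose i _)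
  ds≡rs-transpose zero    M = refl
  ds≡rs-transpose (suc i) M = cong₄-++ (rs≡ds-transpose i _) (ds≡rs-transpose i _)
                                       (ds≡rs-transpose i _) (ls≡us-transpose i _)
  us≡ls-transpose zero    M = refl
  us≡ls-transpose (suc i) M = cong₄-++ (ls≡us-transpose i _) (us≡ls-transpose i _)
                                       (us≡ls-transpose i _) (rs≡ds-transpose i _)
  ls≡us-transpose zero    M = refl
  ls≡us-transpose (suc i) M = cong₄-++ (us≡ls-transpose i _) (ls≡us-transpose i _)
                                       (ls≡us-transpose i _) (ds≡rs-transpose i _)

  rs≡ds-symmetric : ∀ i {M : Mat A i} → M ≗₂ transpose M → rs i M ≡ ds i M
  rs≡ds-symmetric i {M} M-sym = trans (rs≡ds-transpose i M) (ds-cong i λ r c → sym (M-sym r c))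

  phlin≡ds-symmetric : ∀ i {M : Mat A i} → M ≗₂ transpose M → phlin i M ≡ ds i M
  phlin≡ds-symmetric i M-sym with isEven i
  ... | true  = refl
  ... | false = rs≡ds-symmetric i M-sym

  module _ (x : A) where

    const : ∀ i → Mat A i
    const i _ _ = x

    rs-const : ∀ i → rs i (const i) ≡ replicate (4 ^ i) x
    ds-const : ∀ i → ds i (const i) ≡ replicate (4 ^ i) x
    us-const : ∀ i → us i (const i) ≡ replicate (4 ^ i) x
    ls-const : ∀ i → ls i (const i) ≡ replicate (4 ^ i) x
    rs-const zero    = refl
    rs-const (suc i) = trans (cong₄-++ (ds-const i) (rs-const i) (rs-const i) (us-const i))
                             (sym (replicate-4* (4 ^ i) x))
    ds-const zero    = refl
    ds-const (suc i) = trans (cong₄-++ (rs-const i) (ds-const i) (ds-const i) (ls-const i))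
                             (sym (replicate-4* (4 ^ i) x))
    us-const zero    = refl
    us-const (suc i) = trans (cong₄-++ (ls-const i) (us-const i) (us-const i) (rs-const i))
                             (sym (replicate-4* (4 ^ i) x))
    ls-const zero    = refl
    ls-const (suc i) = trans (cong₄-++ (us-const i) (ls-const i) (ls-const i) (ds-const i))
                             (sym (replicate-4* (4 ^ i) x))

lo-injective : ∀ i → Injective _≡_ _≡_ (lo i)
lo-injective i = ↑ˡ-injective _ _ _

hi-injective : ∀ i → Injective _≡_ _≡_ (hi i)
hi-injective i p = ↑ˡ-injective 0 _ _ (↑ʳ-injective (2 ^ i) _ _ p)

lo≢hi : ∀ i (r c : Fin (2 ^ i)) → lo i r ≢ hi i c
lo≢hi i r c p with () ← trans (sym (splitAt-↑ˡ (2 ^ i) r _))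
                              (trans (cong (splitAt (2 ^ i)) p) (splitAt-↑ʳ (2 ^ i) _ _))

I-symmetric : ∀ k → I k ≗₂ transpose (I k)
I-symmetric k r c = cong (if_then 1 else 0) (does-⇔ (mk⇔ sym sym) (r ≟ c) (c ≟ r))

I-reindex : ∀ k m {f : Fin (2 ^ k) → Fin (2 ^ m)} → Injective _≡_ _≡_ f →
            (λ r c → I m (f r) (f c)) ≗₂ I k
I-reindex k m {f} f-inj r c =
  cong (if_then 1 else 0) (does-⇔ (mk⇔ f-inj (cong f)) (f r ≟ f c) (r ≟ c))

I-reindex-disjoint : ∀ k m {f g : Fin (2 ^ k) → Fin (2 ^ m)} → (∀ r c → f r ≢ g c) →
                     (λ r c → I m (f r) (g c)) ≗₂ const 0 k
I-reindex-disjoint k m {f} {g} f≢g r c =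
  cong (if_then 1 else 0) (dec-false (f r ≟ g c) (f≢g r c))

lemma9 : ∀ k →
    phlin (suc k) (I (suc k))
      ≡ phlin k (I k) ++ replicate (4 ^ k) 0 ++ phlin k (I k) ++ replicate (4 ^ k) 0
lemma9 k = begin
  phlin (suc k) (I (suc k))
    ≡⟨ phlin≡ds-symmetric (suc k) (I-symmetric (suc k)) ⟩
  rs k (UL k (I (suc k))) ++ ds k (LL k (I (suc k))) ++ ds k (LR k (I (suc k))) ++ ls k (UR k (I (suc k)))
    ≡⟨ cong₄-++ (rs-cong k (I-reindex k (suc k) (lo-injective k)))
                (ds-cong k (I-reindex-disjoint k (suc k) λ r c p → lo≢hi k c r (sym p)))
                (ds-cong k (I-reindex k (suc k) (hi-injective k)))
                (ls-cong k (I-reindex-disjoint k (suc k) (lo≢hi k))) ⟩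
  rs k (I k) ++ ds k (const 0 k) ++ ds k (I k) ++ ls k (const 0 k)
    ≡⟨ cong₄-++ (trans (rs≡ds-symmetric k (I-symmetric k)) (sym phlin-I))
                (ds-const 0 k) (sym phlin-I) (ls-const 0 k) ⟩
  phlin k (I k) ++ replicate (4 ^ k) 0 ++ phlin k (I k) ++ replicate (4 ^ k) 0
    ∎
  where
  open ≡-Reasoning
  phlin-I : phlin k (I k) ≡ ds k (I k)
  phlin-I = phlin≡ds-symmetric k (I-symmetric k)
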